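{- Let $P$ be a uniform poset of length $n$ and $t\in\mathbb P$. Then $R:=(P\ast T_{t,n})^+$ is uniform of length $n+1$. Moreover, if $x\in P$ and $y\in R$ satisfy $r_P(x)=r_R(y)=k$, then $[y,\hat1_R]\cong([x,\hat1_P]\ast T_{t,n-k})^+$.
   Context: A bounded ranked poset $P$ (with minimum $\hat0_P$, maximum $\hat1_P$) is uniform if $[x,\hat1_P]\cong[y,\hat1_P]$ whenever $r_P(x)=r_P(y)$. $T_{t,m}$ is the poset whose Hasse diagram is a complete $t$-ary rooted tree of height $m$ with root at the bottom (every non-leaf has $t$ children, all leaves at distance $m$ from the root). For ranked $P,Q$, the Rees product $P\ast Q=\{(p,q): r_P(p)\ge r_Q(q)\}$ with $(p_1,q_1)\le(p_2,q_2)$ iff $p_1\le p_2$, $q_1\le q_2$, $r_P(p_2)-r_P(p_1)\ge r_Q(q_2)-r_Q(q_1)$. $X^+$ denotes $X$ with a new maximum element adjoined. -}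

module Defs where

open import Level using (0ℓ)
open import Data.Nat using (ℕ; zero; suc; _+_; _∸_) renaming (_≤_ to _≤ℕ_)
open import Data.Nat.Properties
  using (≤-reflexive; ≤-trans; +-comm; +-assoc; +-mono-≤; +-cancelˡ-≤)
open import Data.Fin using (Fin)
open import Data.Nat.Tactic.RingSolver using (solve-∀)
open import Data.List using (List; []; _∷_; _++_; length)
open import Data.List.Properties using (++-assoc; ++-identityʳ; ++-identityʳ-unique; ++-conicalˡ)
open import Data.List.Relation.Unary.Any using (Any)
open import Data.Maybe using (Maybe; just; nothing)
open import Data.Product using (Σ; _×_; _,_; proj₁; proj₂)
open import Data.Sum using (_⊎_)
open import Data.Empty using (⊥)
open import Data.Unit using (⊤; tt)
open import Relation.Nullary using (¬_)
open import Relation.Binary using (Rel)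
open import Relation.Binary.Bundles using (Poset)
open import Relation.Binary.Structures using (IsEquivalence; IsPreorder; IsPartialOrder)
open import Relation.Binary.Morphism.Structures using (IsOrderIsomorphism)
open import Relation.Binary.PropositionalEquality
  using (_≡_; refl; cong; cong₂) renaming (sym to ≡sym; trans to ≡trans)

Poset₀ : Set₁
Poset₀ = Poset 0ℓ 0ℓ 0ℓ

_≅_ : Poset₀ → Poset₀ → Set
P ≅ Q = Σ (Poset.Carrier P → Poset.Carrier Q) λ f →
  IsOrderIsomorphism (Poset._≈_ P) (Poset._≈_ Q) (Poset._≤_ P) (Poset._≤_ Q) f

record RPoset : Set₁ where
  field
    poset : Poset₀
  open Poset poset public
  field
    rank      : Carrier → ℕ
    rank-resp : ∀ {x y} → x ≈ y → rank x ≡ rank y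

module _ (P : Poset₀) where
  open Poset P
  Covers : Carrier → Carrier → Set
  Covers x y = (x ≤ y × ¬ (x ≈ y)) ×
               (∀ z → x ≤ z → z ≤ y → (z ≈ x) ⊎ (z ≈ y))

  Finite : Set
  Finite = Σ (List Carrier) λ xs → ∀ x → Any (x ≈_) xs

record IsBoundedRanked (P : RPoset) : Set where
  open RPoset P
  field
    finite    : Finite poset
    bot       : Carrier
    top       : Carrier
    bot-min   : ∀ x → bot ≤ x
    top-max   : ∀ x → x ≤ top
    rank-bot  : rank bot ≡ 0
    rank-cov  : ∀ x y → Covers poset x y → rank y ≡ suc (rank x)

  len : ℕ
  len = rank top

-- Upper interval [x, ∞) = {z : x ≤ z}  (equals [x, 1̂] for bounded P)

Up : (P : Poset₀) → Poset.Carrier P → Poset₀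
Up P x = record
  { Carrier = Σ Carrier (x ≤_)
  ; _≈_ = λ a b → proj₁ a ≈ proj₁ b
  ; _≤_ = λ a b → proj₁ a ≤ proj₁ b
  ; isPartialOrder = record
    { isPreorder = record
      { isEquivalence = record { refl = Eq.refl ; sym = Eq.sym ; trans = Eq.trans }
      ; reflexive = reflexive
      ; trans = trans' }
    ; antisym = antisym }
  }
  where open Poset P renaming (trans to trans')

UpR : (P : RPoset) → RPoset.Carrier P → RPoset
UpR P x = record
  { poset = Up (RPoset.poset P) x
  ; rank = λ z → RPoset.rank P (proj₁ z) ∸ RPoset.rank P x
  ; rank-resp = λ e → cong (_∸ RPoset.rank P x) (RPoset.rank-resp P e) }

-- X⁺ : adjoin a new maximum element (nothing)

module _ (P : Poset₀) where
  open Poset P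
  _≈⁺_ : Rel (Maybe Carrier) 0ℓ
  just a ≈⁺ just b = a ≈ b
  nothing ≈⁺ nothing = ⊤
  just _ ≈⁺ nothing = ⊥
  nothing ≈⁺ just _ = ⊥

  _≤⁺_ : Rel (Maybe Carrier) 0ℓ
  just a ≤⁺ just b = a ≤ b
  just _ ≤⁺ nothing = ⊤
  nothing ≤⁺ nothing = ⊤
  nothing ≤⁺ just _ = ⊥

  private
    r⁺ : ∀ {a} → a ≈⁺ a
    r⁺ {just a} = Eq.refl
    r⁺ {nothing} = tt
    s⁺ : ∀ {a b} → a ≈⁺ b → b ≈⁺ a
    s⁺ {just a} {just b} e = Eq.sym e
    s⁺ {nothing} {nothing} e = tt
    t⁺ : ∀ {a b c} → a ≈⁺ b → b ≈⁺ c → a ≈⁺ c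
    t⁺ {just a} {just b} {just c} e f = Eq.trans e f
    t⁺ {nothing} {nothing} {nothing} e f = tt
    rf⁺ : ∀ {a b} → a ≈⁺ b → a ≤⁺ b
    rf⁺ {just a} {just b} e = reflexive e
    rf⁺ {just a} {nothing} e = tt
    rf⁺ {nothing} {nothing} e = tt
    tr⁺ : ∀ {a b c} → a ≤⁺ b → b ≤⁺ c → a ≤⁺ c
    tr⁺ {just a} {just b} {just c} e f = trans e f
    tr⁺ {just _} {_} {nothing} e f = tt
    tr⁺ {nothing} {_} {nothing} e f = tt
    tr⁺ {just a} {nothing} {just c} e ()
    tr⁺ {nothing} {just b} {just c} () f
    tr⁺ {nothing} {nothing} {just c} e ()
    an⁺ : ∀ {a b} → a ≤⁺ b → b ≤⁺ a → a ≈⁺ b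
    an⁺ {just a} {just b} e f = antisym e f
    an⁺ {just a} {nothing} e ()
    an⁺ {nothing} {just b} () f
    an⁺ {nothing} {nothing} e f = tt

  _⁺ : Poset₀
  _⁺ = record
    { Carrier = Maybe Carrier
    ; _≈_ = _≈⁺_
    ; _≤_ = _≤⁺_
    ; isPartialOrder = record
      { isPreorder = record
        { isEquivalence = record { refl = λ {x} → r⁺ {x} ; sym = λ {x} {y} → s⁺ {x} {y} ; trans = λ {x} {y} {z} → t⁺ {x} {y} {z} }
        ; reflexive = λ {x} {y} → rf⁺ {x} {y}
        ; trans = λ {x} {y} {z} → tr⁺ {x} {y} {z} }
      ; antisym = λ {x} {y} → an⁺ {x} {y} }
    }

-- Rees product P ∗ Q = {(p,q) : r_P(p) ≥ r_Q(q)},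
-- (p₁,q₁) ≤ (p₂,q₂) iff p₁ ≤ p₂, q₁ ≤ q₂ and
-- r_P(p₂) - r_P(p₁) ≥ r_Q(q₂) - r_Q(q₁)   (integer subtraction; stated
-- equivalently in ℕ as r_Q(q₂) + r_P(p₁) ≤ r_P(p₂) + r_Q(q₁)).

private
  swap4 : ∀ a b c d → (a + b) + (c + d) ≡ (a + d) + (c + b)
  swap4 = solve-∀

  rees-trans : ∀ p1 p2 p3 q1 q2 q3 →
    q2 + p1 ≤ℕ p2 + q1 → q3 + p2 ≤ℕ p3 + q2 → q3 + p1 ≤ℕ p3 + q1
  rees-trans p1 p2 p3 q1 q2 q3 a b =
    +-cancelˡ-≤ (p2 + q2) (q3 + p1) (p3 + q1)
      (≤-trans (≤-reflexive e1) (≤-trans (+-mono-≤ b a) (≤-reflexive e2)))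
    where
    e1 : (p2 + q2) + (q3 + p1) ≡ (q3 + p2) + (q2 + p1)
    e1 = ≡trans (cong (_+ (q3 + p1)) (+-comm p2 q2))
         (≡trans (swap4 q2 p2 q3 p1)
         (≡trans (cong (_+ (q3 + p2)) (+-comm q2 p1))
         (≡trans (+-comm (p1 + q2) (q3 + p2)) (cong ((q3 + p2) +_) (+-comm p1 q2)))))
    e2 : (p3 + q2) + (p2 + q1) ≡ (p2 + q2) + (p3 + q1)
    e2 = ≡trans (swap4 p3 q2 p2 q1)
         (≡trans (+-comm (p3 + q1) (p2 + q2)) refl)

_∗_ : RPoset → RPoset → Poset₀
P ∗ Q = record
  { Carrier = Σ (P.Carrier × Q.Carrier) (λ pq → Q.rank (proj₂ pq) ≤ℕ P.rank (proj₁ pq))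
  ; _≈_ = λ a b → (proj₁ (proj₁ a) P.≈ proj₁ (proj₁ b)) × (proj₂ (proj₁ a) Q.≈ proj₂ (proj₁ b))
  ; _≤_ = λ a b → RL (proj₁ a) (proj₁ b)
  ; isPartialOrder = record
    { isPreorder = record
      { isEquivalence = record
        { refl = P.Eq.refl , Q.Eq.refl
        ; sym = λ (e , f) → P.Eq.sym e , Q.Eq.sym f
        ; trans = λ (e , f) (e' , f') → P.Eq.trans e e' , Q.Eq.trans f f' }
      ; reflexive = λ {a} {b} (e , f) → P.reflexive e , Q.reflexive f ,
          ≤-reflexive (≡trans (cong₂ _+_ (≡sym (Q.rank-resp f)) (P.rank-resp e))
                             (+-comm (Q.rank (proj₂ (proj₁ a))) (P.rank (proj₁ (proj₁ b)))))
      ; trans = λ {a} {b} {c} (e , f , g) (e' , f' , g') →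
          P.trans e e' , Q.trans f f' ,
          rees-trans (P.rank (proj₁ (proj₁ a))) (P.rank (proj₁ (proj₁ b))) (P.rank (proj₁ (proj₁ c)))
                     (Q.rank (proj₂ (proj₁ a))) (Q.rank (proj₂ (proj₁ b))) (Q.rank (proj₂ (proj₁ c))) g g' }
    ; antisym = λ (e , f , _) (e' , f' , _) → P.antisym e e' , Q.antisym f f' }
  }
  where
  module P = RPoset P
  module Q = RPoset Q
  RL : Rel (P.Carrier × Q.Carrier) 0ℓ
  RL (p₁ , q₁) (p₂ , q₂) = (p₁ P.≤ p₂) × (q₁ Q.≤ q₂) ×
                           (Q.rank q₂ + P.rank p₁ ≤ℕ P.rank p₂ + Q.rank q₁)

-- T_{t,m}: complete t-ary rooted tree of height m, root at the bottom.
-- Vertices = words over Fin t of length ≤ m (root = empty word);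
-- u ≤ w iff u is a prefix of w; rank = length (depth).

T : ℕ → ℕ → RPoset
T t m = record
  { poset = record
    { Carrier = Σ (List (Fin t)) (λ w → length w ≤ℕ m)
    ; _≈_ = λ a b → proj₁ a ≡ proj₁ b
    ; _≤_ = λ a b → Σ (List (Fin t)) λ s → proj₁ a ++ s ≡ proj₁ b
    ; isPartialOrder = record
      { isPreorder = record
        { isEquivalence = record { refl = refl ; sym = ≡sym ; trans = ≡trans }
        ; reflexive = λ e → [] , ≡trans (++-identityʳ _) e
        ; trans = λ {a} (s , e) (s' , e') →
            s ++ s' , ≡trans (≡sym (++-assoc (proj₁ a) s s'))
                            (≡trans (cong (_++ s') e) e') }
      ; antisym = λ {a} {b} (s , e) (s' , e') → antisym' (proj₁ a) (proj₁ b) s s' e e' }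
    }
  ; rank = λ w → length (proj₁ w)
  ; rank-resp = cong length
  }
  where
  antisym' : (u w s s' : List (Fin t)) → u ++ s ≡ w → w ++ s' ≡ u → u ≡ w
  antisym' u w s s' e e' =
    let ss'≡[] = ++-identityʳ-unique u
                   (≡sym (≡trans (≡sym (++-assoc u s s')) (≡trans (cong (_++ s') e) e')))
        s≡[] = ++-conicalˡ s s' ss'≡[]
    in ≡trans (≡sym (++-identityʳ u)) (≡trans (cong (u ++_) (≡sym s≡[])) e)

record Uniform (P : RPoset) : Set where
  field
    boundedRanked : IsBoundedRanked P
    uniform : ∀ x y → RPoset.rank P x ≡ RPoset.rank P y →
              Up (RPoset.poset P) x ≅ Up (RPoset.poset P) y
  open IsBoundedRanked boundedRanked public

withRank : (X : Poset₀) (r : Poset.Carrier X → ℕ) →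
           (∀ {a b} → Poset._≈_ X a b → r a ≡ r b) → RPoset
withRank X r resp = record { poset = X ; rank = r ; rank-resp = resp }

module Submission where

-- R is ranked by the rank of the first coordinate, the new maximum having rank
-- n + 1.  The heart of the proof describes upper intervals: above y = (p, q) in
-- P ∗ T_{t,n} only the part of a tree word beyond q matters, so
-- [y, ∞) ≅ [p, ∞) ∗ T_{t,n-k} with k = r(p); uniformity of P replaces [p, ∞) by
-- [x, ∞) (an isomorphism of upper sets with bases of equal rank preserves
-- ranks), and adjoining a maximum commutes with taking upper sets.  Uniformity
-- of R follows, as elements of equal rank get intervals isomorphic to one poset.
-- That covers in R raise the rank by one comes from interpolation: if
-- (p₁, q₁) ⋖ (p₂, q₂) then p₁ ⋖ p₂.
--
-- Facts about ranks in P (monotonicity, rank preservation) are proved by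
-- induction along covers, which needs a decidable order.  As P is finite and
-- these facts are decidable statements about ℕ, decidability of the order may
-- be assumed: finitely many instances of excluded middle hold under double
-- negation.

open import Defs
open import Level using (0ℓ)
open import Function.Base using (id; _∘_; _on_)
open import Function.Bundles using (_⇔_; mk⇔; Equivalence)
open import Data.Nat using (ℕ; zero; suc; _+_; _∸_; z≤n; s≤s; _≟_)
  renaming (_≤_ to _≤ℕ_; _<_ to _<ℕ_; _≤?_ to _≤ℕ?_)
open import Data.Nat.Properties
  using (≤-trans; ≤-reflexive; <⇒≤; m≤n⇒m≤1+n; 1+n≰n; m≤n+m; suc-injective;
         +-assoc; +-comm; +-suc; +-identityʳ; +-cancelˡ-≤; +-cancelʳ-≡; +-monoʳ-≤;
         m∸n+n≡m; m+n≤o⇒m≤o∸n; m≤o∸n⇒m+n≤o; ∸-monoˡ-≤; module ≤-Reasoning)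
open import Data.Nat.Induction using (<-wellFounded)
open import Data.Fin using (Fin)
open import Data.List using (List; []; _∷_; _++_; length; map; concat; cartesianProductWith; allFin)
open import Data.List.Properties using (length-++; length-++-≤ˡ; ++-identityʳ; ++-assoc; ++-cancelˡ)
open import Data.List.Relation.Unary.All as All using (All; lookupAny; universal)
open import Data.List.Relation.Unary.Any as Any using (Any; here; there; any?; satisfied)
open import Data.List.Relation.Unary.Any.Properties using (map⁺; concat⁺; cartesianProductWith⁺)
open import Data.List.Membership.Propositional.Properties using (∈-allFin)
open import Data.Maybe as Maybe using (Maybe; just; nothing)
open import Data.Product using (Σ; _×_; _,_; proj₁; proj₂)
open import Data.Sum as Sum using (_⊎_; inj₁; inj₂; [_,_]′)
open import Data.Unit using (tt)
open import Data.Empty using (⊥-elim)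
open import Effect.Monad using (RawMonad)
open import Induction.WellFounded using (Acc; acc)
import Relation.Binary.Construct.On as On
open import Relation.Binary.Core using (Rel)
open import Relation.Binary.Bundles using (Poset)
open import Relation.Binary.Definitions using (Decidable; _Respects₂_)
open import Relation.Binary.Morphism.Structures using (IsOrderIsomorphism)
import Relation.Binary.Morphism.Construct.Identity as Identity
import Relation.Binary.Morphism.Construct.Composition as Composition
import Relation.Binary.Properties.Poset as PosetProperties
open import Relation.Binary.PropositionalEquality as ≡ using (_≡_; refl; subst; subst₂)
open import Relation.Nullary using (¬_; Dec; yes; no)
open import Relation.Nullary.Decidable using (map′; decidable-stable; ¬¬-excluded-middle; _×-dec_; ¬?)
open import Relation.Nullary.Negation using (¬¬-Monad; ¬¬-map)

module _ {A B : Poset₀} where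
  private
    module A = Poset A
    module B = Poset B

  mk≅ : (f : A.Carrier → B.Carrier) (g : B.Carrier → A.Carrier) →
        (∀ {a₁ a₂} → a₁ A.≤ a₂ → f a₁ B.≤ f a₂) →
        (∀ {b₁ b₂} → b₁ B.≤ b₂ → g b₁ A.≤ g b₂) →
        (∀ b → f (g b) B.≈ b) → (∀ a → g (f a) A.≈ a) → A ≅ B
  mk≅ f g f-mono g-mono fg gf = f , record
    { isOrderMonomorphism = record
      { isOrderHomomorphism = record { cong = f-cong ; mono = f-mono }
      ; injective = λ {a₁} {a₂} e →
          A.Eq.trans (A.Eq.sym (gf a₁)) (A.Eq.trans (g-cong e) (gf a₂))
      ; cancel = λ {a₁} {a₂} le →
          A.trans (A.reflexive (A.Eq.sym (gf a₁))) (A.trans (g-mono le) (A.reflexive (gf a₂))) }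
    ; surjective = λ b → g b , λ e → B.Eq.trans (f-cong e) (fg b) }
    where
    f-cong : ∀ {a₁ a₂} → a₁ A.≈ a₂ → f a₁ B.≈ f a₂
    f-cong e = B.antisym (f-mono (A.reflexive e)) (f-mono (A.reflexive (A.Eq.sym e)))
    g-cong : ∀ {b₁ b₂} → b₁ B.≈ b₂ → g b₁ A.≈ g b₂
    g-cong e = A.antisym (g-mono (B.reflexive e)) (g-mono (B.reflexive (B.Eq.sym e)))

module Iso {A B : Poset₀} (i : A ≅ B) where
  private
    module A = Poset A
    module B = Poset B
    module I = IsOrderIsomorphism (proj₂ i)

  to : A.Carrier → B.Carrier
  to = proj₁ i

  open I public using (cong; mono; injective; cancel)

  from : B.Carrier → A.Carrier
  from b = proj₁ (I.surjective b)

  to-from : ∀ b → to (from b) B.≈ b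
  to-from b = proj₂ (I.surjective b) A.Eq.refl

  from-to : ∀ a → from (to a) A.≈ a
  from-to a = injective (to-from (to a))

  from-mono : ∀ {b₁ b₂} → b₁ B.≤ b₂ → from b₁ A.≤ from b₂
  from-mono {b₁} {b₂} le =
    cancel (B.trans (B.reflexive (to-from b₁)) (B.trans le (B.reflexive (B.Eq.sym (to-from b₂)))))

≅-refl : (A : Poset₀) → A ≅ A
≅-refl A = id , Identity.isOrderIsomorphism (Poset._≈_ A) (Poset._≤_ A) (Poset.Eq.refl A)

≅-sym : {A B : Poset₀} → A ≅ B → B ≅ A
≅-sym {A} {B} i = mk≅ {B} {A} from to from-mono mono from-to to-from
  where open Iso {A} {B} i

≅-trans : {A B C : Poset₀} → A ≅ B → B ≅ C → A ≅ C
≅-trans {C = C} (f , f-iso) (g , g-iso) =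
  g ∘ f , Composition.isOrderIsomorphism (Poset.Eq.trans C) f-iso g-iso

-- Chains of isomorphisms  begin A ≅⟨ i ⟩ B ≅⟨ j ⟩ C ∎, naming every poset
-- on the way (Agda cannot infer posets from the type of an isomorphism).
module ≅-Reasoning where
  infix  1 begin_
  infixr 2 _≅⟨_⟩_ _≅˘⟨_⟩_
  infix  3 _∎

  record _IsoTo_ (A B : Poset₀) : Set where
    constructor isoTo
    field iso : A ≅ B

  begin_ : {A B : Poset₀} → A IsoTo B → A ≅ B
  begin isoTo i = i

  _≅⟨_⟩_ : (A : Poset₀) {B C : Poset₀} → A ≅ B → B IsoTo C → A IsoTo C
  _≅⟨_⟩_ A {B} {C} i (isoTo j) = isoTo (≅-trans {A} {B} {C} i j)

  _≅˘⟨_⟩_ : (A : Poset₀) {B C : Poset₀} → B ≅ A → B IsoTo C → A IsoTo C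
  _≅˘⟨_⟩_ A {B} {C} i (isoTo j) = isoTo (≅-trans {A} {B} {C} (≅-sym {B} {A} i) j)

  _∎ : (A : Poset₀) → A IsoTo A
  A ∎ = isoTo (≅-refl A)

≅-least : {A B : Poset₀} (i : A ≅ B) {a₀ : Poset.Carrier A} {b₀ : Poset.Carrier B} →
          (∀ a → Poset._≤_ A a₀ a) → (∀ b → Poset._≤_ B b₀ b) →
          Poset._≈_ B (proj₁ i a₀) b₀
≅-least {A} {B} i {a₀} {b₀} a₀-least b₀-least =
  B.antisym (B.trans (mono (a₀-least (from b₀))) (B.reflexive (to-from b₀))) (b₀-least (to a₀))
  where
  module B = Poset B
  open Iso {A} {B} i

≅-covers : {A B : Poset₀} (i : A ≅ B) {a b : Poset.Carrier A} →
           Covers A a b → Covers B (proj₁ i a) (proj₁ i b)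
≅-covers {A} {B} i {a} {b} ((a≤b , a≉b) , between) =
  (mono a≤b , a≉b ∘ injective) , λ z a≤z z≤b →
    Sum.map (transport z) (transport z)
      (between (from z) (cancel (B.trans a≤z (B.reflexive (B.Eq.sym (to-from z)))))
                        (cancel (B.trans (B.reflexive (to-from z)) z≤b)))
  where
  module B = Poset B
  open Iso {A} {B} i
  transport : ∀ z {c} → Poset._≈_ A (from z) c → z B.≈ to c
  transport z e = B.Eq.trans (B.Eq.sym (to-from z)) (cong e)

module _ (A : Poset₀) {p : Poset.Carrier A} where
  open Poset A

  up-covers : {a b : Σ Carrier (p ≤_)} → Covers A (proj₁ a) (proj₁ b) → Covers (Up A p) a b
  up-covers (a<b , between) = a<b , λ z → between (proj₁ z)

  up-covers⁻ : {a b : Σ Carrier (p ≤_)} → Covers (Up A p) a b → Covers A (proj₁ a) (proj₁ b)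
  up-covers⁻ {a} (a<b , between) = a<b , λ z a≤z → between (z , trans (proj₂ a) a≤z) a≤z

⁺-cong : {A B : Poset₀} → A ≅ B → (A ⁺) ≅ (B ⁺)
⁺-cong {A} {B} i = mk≅ {A ⁺} {B ⁺} (Maybe.map to) (Maybe.map from)
  (λ {u} {v} → lift-mono A B to mono {u} {v}) (λ {u} {v} → lift-mono B A from from-mono {u} {v})
  (lift-inverse A B to to-from) (lift-inverse B A from from-to)
  where
  open Iso {A} {B} i
  lift-mono : ∀ X Y (f : Poset.Carrier X → Poset.Carrier Y) →
              (∀ {a b} → Poset._≤_ X a b → Poset._≤_ Y (f a) (f b)) →
              ∀ {u v} → Poset._≤_ (X ⁺) u v → Poset._≤_ (Y ⁺) (Maybe.map f u) (Maybe.map f v)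
  lift-mono X Y f f-mono {just _} {just _} le = f-mono le
  lift-mono X Y f f-mono {just _} {nothing} _ = tt
  lift-mono X Y f f-mono {nothing} {nothing} _ = tt
  lift-inverse : ∀ X Y (g : Poset.Carrier X → Poset.Carrier Y) {h} →
                 (∀ a → Poset._≈_ Y (g (h a)) a) →
                 ∀ u → Poset._≈_ (Y ⁺) (Maybe.map g (Maybe.map h u)) u
  lift-inverse X Y g inverse (just a) = inverse a
  lift-inverse X Y g inverse nothing = tt

up-⁺ : (A : Poset₀) (a : Poset.Carrier A) → Up (A ⁺) (just a) ≅ (Up A a ⁺)
up-⁺ A a = mk≅ {Up (A ⁺) (just a)} {Up A a ⁺} to from
  (λ {u} {v} → to-mono {u} {v}) (λ {u} {v} → from-mono {u} {v}) to-from from-to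
  where
  open Poset A
  to : Σ (Maybe Carrier) (_≤⁺_ A (just a)) → Maybe (Σ Carrier (a ≤_))
  to (just b , a≤b) = just (b , a≤b)
  to (nothing , _) = nothing
  from : Maybe (Σ Carrier (a ≤_)) → Σ (Maybe Carrier) (_≤⁺_ A (just a))
  from (just (b , a≤b)) = just b , a≤b
  from nothing = nothing , tt
  to-mono : ∀ {u v} → Poset._≤_ (Up (A ⁺) (just a)) u v → Poset._≤_ (Up A a ⁺) (to u) (to v)
  to-mono {just _ , _} {just _ , _} le = le
  to-mono {just _ , _} {nothing , _} _ = tt
  to-mono {nothing , _} {nothing , _} _ = tt
  from-mono : ∀ {u v} → Poset._≤_ (Up A a ⁺) u v → Poset._≤_ (Up (A ⁺) (just a)) (from u) (from v)
  from-mono {just _} {just _} le = le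
  from-mono {just _} {nothing} _ = tt
  from-mono {nothing} {nothing} _ = tt
  to-from : ∀ u → Poset._≈_ (Up A a ⁺) (to (from u)) u
  to-from (just _) = Eq.refl
  to-from nothing = tt
  from-to : ∀ u → Poset._≈_ (Up (A ⁺) (just a)) (from (to u)) u
  from-to (just _ , _) = Eq.refl
  from-to (nothing , _) = tt

∗-congˡ : (X Y Q : RPoset) (i : RPoset.poset X ≅ RPoset.poset Y) →
          (∀ a → RPoset.rank Y (proj₁ i a) ≡ RPoset.rank X a) → (X ∗ Q) ≅ (Y ∗ Q)
∗-congˡ X Y Q i to-rank = mk≅ {X ∗ Q} {Y ∗ Q} to′ from′
  (λ (a₁≤a₂ , q₁≤q₂ , rees) → mono a₁≤a₂ , q₁≤q₂ ,
     subst₂ (λ r₁ r₂ → _ + r₁ ≤ℕ r₂ + _) (≡.sym (to-rank _)) (≡.sym (to-rank _)) rees)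
  (λ (b₁≤b₂ , q₁≤q₂ , rees) → from-mono b₁≤b₂ , q₁≤q₂ ,
     subst₂ (λ r₁ r₂ → _ + r₁ ≤ℕ r₂ + _) (≡.sym (from-rank _)) (≡.sym (from-rank _)) rees)
  (λ _ → to-from _ , Q.Eq.refl) (λ _ → from-to _ , Q.Eq.refl)
  where
  module Q = RPoset Q
  open Iso {RPoset.poset X} {RPoset.poset Y} i
  from-rank : ∀ b → RPoset.rank X (from b) ≡ RPoset.rank Y b
  from-rank b = ≡.trans (≡.sym (to-rank (from b))) (RPoset.rank-resp Y (to-from b))
  to′ : Poset.Carrier (X ∗ Q) → Poset.Carrier (Y ∗ Q)
  to′ ((a , q) , h) = (to a , q) , subst (Q.rank q ≤ℕ_) (≡.sym (to-rank a)) h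
  from′ : Poset.Carrier (Y ∗ Q) → Poset.Carrier (X ∗ Q)
  from′ ((b , q) , h) = (from b , q) , subst (Q.rank q ≤ℕ_) (≡.sym (from-rank b)) h

¬¬-all : {X : Set} {Q : X → Set} → (∀ x → ¬ ¬ Q x) → ∀ xs → ¬ ¬ All Q xs
¬¬-all h xs = All.sequenceA 0ℓ (RawMonad.rawApplicative ¬¬-Monad) (universal h xs)

module _ {A : Poset₀} (fin : Finite A) where
  open Poset A

  -- A relation on a finite poset that respects ≈ is decidable, classically:
  -- it suffices to decide it on the finitely many listed representatives.
  ¬¬-decidable : {R : Rel Carrier 0ℓ} → R Respects₂ _≈_ → ¬ ¬ Decidable R
  ¬¬-decidable {R} (respʳ , respˡ) =
    ¬¬-map decide (¬¬-all (λ _ → ¬¬-all (λ _ → ¬¬-excluded-middle) enum) enum)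
    where
    enum = proj₁ fin
    decide : All (λ a → All (λ b → Dec (R a b)) enum) enum → Decidable R
    decide table a b with lookupAny table (proj₂ fin a)
    ... | row , a≈a′ with lookupAny row (proj₂ fin b)
    ... | R? , b≈b′ =
      map′ (respˡ (Eq.sym a≈a′) ∘ respʳ (Eq.sym b≈b′)) (respˡ a≈a′ ∘ respʳ b≈b′) R?

  classically : {G : Set} → Dec G → (Decidable _≤_ → G) → G
  classically G? proof = decidable-stable G? (λ ¬G → ¬¬-decidable ≤-resp-≈ (¬G ∘ proof))

count : {X : Set} {Q : X → Set} → (∀ x → Dec (Q x)) → List X → ℕ
count Q? [] = 0
count Q? (x ∷ xs) with Q? x
... | yes _ = suc (count Q? xs)
... | no _ = count Q? xs

module _ {X : Set} {Q R : X → Set} (Q? : ∀ x → Dec (Q x)) (R? : ∀ x → Dec (R x))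
         (Q⇒R : ∀ {x} → Q x → R x) where

  count-mono : ∀ xs → count Q? xs ≤ℕ count R? xs
  count-mono [] = z≤n
  count-mono (x ∷ xs) with Q? x | R? x
  ... | yes _ | yes _ = s≤s (count-mono xs)
  ... | yes q | no ¬r = ⊥-elim (¬r (Q⇒R q))
  ... | no _  | yes _ = m≤n⇒m≤1+n (count-mono xs)
  ... | no _  | no _  = count-mono xs

  count-< : ∀ {xs} → Any (λ x → R x × ¬ Q x) xs → count Q? xs <ℕ count R? xs
  count-< {x ∷ xs} (here (r , ¬q)) with Q? x | R? x
  ... | yes q | _     = ⊥-elim (¬q q)
  ... | no _  | yes _ = s≤s (count-mono xs)
  ... | no _  | no ¬r = ⊥-elim (¬r r)
  count-< {x ∷ xs} (there witness) with Q? x | R? x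
  ... | yes _ | yes _ = s≤s (count-< witness)
  ... | yes q | no ¬r = ⊥-elim (¬r (Q⇒R q))
  ... | no _  | yes _ = m≤n⇒m≤1+n (count-< witness)
  ... | no _  | no _  = count-< witness

module FiniteOrder {A : Poset₀} (fin : Finite A) (_≤?_ : Decidable (Poset._≤_ A)) where
  open Poset A renaming (refl to ≤-refl)
  open PosetProperties A using (_<_; <-respˡ-≈; <-respʳ-≈; ≤-dec⇒≈-dec)

  private
    enum = proj₁ fin
    enum-complete = proj₂ fin

    _≈?_ : Decidable _≈_
    _≈?_ = ≤-dec⇒≈-dec _≤?_

    _<?_ : Decidable _<_
    a <? b = (a ≤? b) ×-dec ¬? (a ≈? b)

    #above #below : Carrier → ℕ
    #above a = count (a ≤?_) enum
    #below a = count (_≤? a) enum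

    #above-< : ∀ {a b} → a < b → #above b <ℕ #above a
    #above-< {a} (a≤b , a≉b) = count-< (_ ≤?_) (_ ≤?_) (trans a≤b)
      (Any.map (λ a≈a′ → reflexive a≈a′ ,
                         λ b≤a′ → a≉b (antisym a≤b (trans b≤a′ (reflexive (Eq.sym a≈a′)))))
               (enum-complete a))

    #below-< : ∀ {a b} → a < b → #below a <ℕ #below b
    #below-< {b = b} (a≤b , a≉b) = count-< (_≤? _) (_≤? _) (λ x≤a → trans x≤a a≤b)
      (Any.map (λ b≈b′ → reflexive (Eq.sym b≈b′) ,
                         λ b′≤a → a≉b (antisym a≤b (trans (reflexive b≈b′) b′≤a)))
               (enum-complete b))

  cover-below : ∀ {p w} → p < w → Σ Carrier λ c → Covers A p c × c ≤ w
  cover-below {p} {w} = go w (On.wellFounded #below <-wellFounded w)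
    where
    go : ∀ w → Acc (_<ℕ_ on #below) w → p < w → Σ Carrier λ c → Covers A p c × c ≤ w
    go w (acc smaller) p<w with any? (λ v → (p <? v) ×-dec (v <? w)) enum
    ... | yes found =
      let v , p<v , v<w = satisfied found
          c , p⋖c , c≤v = go v (smaller (#below-< v<w)) p<v
      in c , p⋖c , trans c≤v (proj₁ v<w)
    ... | no nothing-between = w , (p<w , between) , ≤-refl
      where
      between : ∀ z → p ≤ z → z ≤ w → z ≈ p ⊎ z ≈ w
      between z p≤z z≤w with z ≈? p | z ≈? w
      ... | yes z≈p | _       = inj₁ z≈p
      ... | no _    | yes z≈w = inj₂ z≈w
      ... | no z≉p  | no z≉w  = ⊥-elim (nothing-between (Any.map
              (λ z≈v → <-respʳ-≈ z≈v (p≤z , z≉p ∘ Eq.sym) , <-respˡ-≈ z≈v (z≤w , z≉w))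
              (enum-complete z)))

  cover-induction : (Q : Carrier → Set) {z : Carrier} → (∀ {u} → u ≈ z → Q u) →
                    (∀ {u c} → Covers A u c → c ≤ z → Q c → Q u) → ∀ {u} → u ≤ z → Q u
  cover-induction Q {z} at-z step {u} = go u (On.wellFounded #above <-wellFounded u)
    where
    go : ∀ u → Acc (_<ℕ_ on #above) u → u ≤ z → Q u
    go u (acc smaller) u≤z with u ≈? z
    ... | yes u≈z = at-z u≈z
    ... | no u≉z =
      let c , u⋖c , c≤z = cover-below (u≤z , u≉z)
      in step u⋖c c≤z (go c (smaller (#above-< (proj₁ u⋖c))) c≤z)

module RankedFacts (P : RPoset) (fin : Finite (RPoset.poset P))
    (rank-cov : ∀ x y → Covers (RPoset.poset P) x y → RPoset.rank P y ≡ suc (RPoset.rank P x)) where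
  open RPoset P renaming (refl to ≤-refl)
  open ≡.≡-Reasoning

  rank-mono : ∀ {x y} → x ≤ y → rank x ≤ℕ rank y
  rank-mono {x} {y} x≤y = classically {poset} fin (rank x ≤ℕ? rank y) λ _≤?_ →
    FiniteOrder.cover-induction {poset} fin _≤?_ (λ u → rank u ≤ℕ rank y) (≤-reflexive ∘ rank-resp)
      (λ {u} {c} u⋖c _ rc≤ry → <⇒≤ (subst (_≤ℕ rank y) (rank-cov u c u⋖c) rc≤ry)) x≤y

  module _ {p x : Carrier} (i : Up poset p ≅ Up poset x) where
    private
      f = proj₁ i
      rank′ : Σ Carrier (x ≤_) → ℕ
      rank′ w = rank (proj₁ w)
      bottom : Σ Carrier (p ≤_)
      bottom = p , ≤-refl

    rank-shift : Decidable _≤_ → ∀ z → rank′ (f z) + rank p ≡ rank (proj₁ z) + rank′ (f bottom)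
    rank-shift _≤?_ (z , p≤z) = FiniteOrder.cover-induction {poset} fin _≤?_ Q at-z step p≤z ≤-refl
      where
      rank-fz : ℕ
      rank-fz = rank′ (f (z , p≤z))
      Q : Carrier → Set
      Q u = (p≤u : p ≤ u) → rank-fz + rank u ≡ rank z + rank′ (f (u , p≤u))
      at-z : ∀ {u} → u ≈ z → Q u
      at-z {u} u≈z p≤u = begin
        rank-fz + rank u              ≡⟨ +-comm _ (rank u) ⟩
        rank u + rank-fz              ≡⟨ ≡.cong₂ _+_ (rank-resp u≈z) (rank-resp (f-cong (Eq.sym u≈z))) ⟩
        rank z + rank′ (f (u , p≤u))  ∎
        where f-cong = Iso.cong {Up poset p} {Up poset x} i
      step : ∀ {u c} → Covers poset u c → c ≤ z → Q c → Q u
      step {u} {c} u⋖c _ Qc p≤u = suc-injective (begin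
        suc (rank-fz + rank u)              ≡⟨ ≡.sym (+-suc _ (rank u)) ⟩
        rank-fz + suc (rank u)              ≡⟨ ≡.cong (rank-fz +_) (≡.sym (rank-cov u c u⋖c)) ⟩
        rank-fz + rank c                    ≡⟨ Qc p≤c ⟩
        rank z + rank′ (f (c , p≤c))        ≡⟨ ≡.cong (rank z +_) (rank-cov _ _ image-covers) ⟩
        rank z + suc (rank′ (f (u , p≤u)))  ≡⟨ +-suc (rank z) _ ⟩
        suc (rank z + rank′ (f (u , p≤u)))  ∎)
        where
        p≤c = trans p≤u (proj₁ (proj₁ u⋖c))
        image-covers : Covers poset (proj₁ (f (u , p≤u))) (proj₁ (f (c , p≤c)))
        image-covers = up-covers⁻ poset {x} {f (u , p≤u)} {f (c , p≤c)}
          (≅-covers {Up poset p} {Up poset x} i (up-covers poset {p} {u , p≤u} {c , p≤c} u⋖c))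

    up-≅-rank : rank p ≡ rank x → ∀ z → rank′ (f z) ≡ rank (proj₁ z)
    up-≅-rank rp≡rx z = classically {poset} fin (rank′ (f z) ≟ rank (proj₁ z)) λ _≤?_ →
      +-cancelʳ-≡ (rank p) _ _ (begin
        rank′ (f z) + rank p             ≡⟨ rank-shift _≤?_ z ⟩
        rank (proj₁ z) + rank′ (f bottom) ≡⟨ ≡.cong (rank (proj₁ z) +_) bottom-rank ⟩
        rank (proj₁ z) + rank p           ∎)
      where
      bottom-rank : rank′ (f bottom) ≡ rank p
      bottom-rank = ≡.trans (rank-resp (≅-least {Up poset p} {Up poset x} i {bottom} {x , ≤-refl} proj₂ proj₂))
                            (≡.sym rp≡rx)

rees-core : ∀ l s r₁ r₂ → ((l + s) + r₁ ≤ℕ r₂ + l) ⇔ (s + r₁ ≤ℕ r₂)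
rees-core l s r₁ r₂ = mk⇔
  (λ h → +-cancelˡ-≤ l _ _ (subst₂ _≤ℕ_ (+-assoc l s r₁) (+-comm r₂ l) h))
  (λ h → subst₂ _≤ℕ_ (≡.sym (+-assoc l s r₁)) (+-comm l r₂) (+-monoʳ-≤ l h))

rees-extension : ∀ {X : Set} (q₁ s : List X) {q₂ r₁ r₂} → q₁ ++ s ≡ q₂ →
                 (length q₂ + r₁ ≤ℕ r₂ + length q₁) ⇔ (length s + r₁ ≤ℕ r₂)
rees-extension q₁ s {r₁ = r₁} {r₂} refl rewrite length-++ q₁ {s} =
  rees-core (length q₁) (length s) r₁ r₂

∸-shift : ∀ {k r₁ r₂} u → k ≤ℕ r₁ → k ≤ℕ r₂ →
          (u + (r₁ ∸ k) ≤ℕ r₂ ∸ k) ⇔ (u + r₁ ≤ℕ r₂)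
∸-shift {k} {r₁} {r₂} u k≤r₁ k≤r₂ = mk⇔
  (λ h → subst (_≤ℕ r₂) shift (m≤o∸n⇒m+n≤o _ k≤r₂ h))
  (λ h → m+n≤o⇒m≤o∸n _ (subst (_≤ℕ r₂) (≡.sym shift) h))
  where
  shift : (u + (r₁ ∸ k)) + k ≡ u + r₁
  shift = ≡.trans (+-assoc u _ k) (≡.cong (u +_) (m∸n+n≡m k≤r₁))

⁺-finite : {A : Poset₀} → Finite A → Finite (A ⁺)
⁺-finite (xs , complete) = nothing ∷ map just xs , λ where
  nothing → here tt
  (just a) → there (map⁺ (complete a))

T-finite : ∀ t m → Finite (RPoset.poset (T t m))
T-finite t m = words m , complete m
  where
  Word : ℕ → Set
  Word m = Σ (List (Fin t)) λ w → length w ≤ℕ m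
  extend : ∀ {m} → Fin t → Word m → Word (suc m)
  extend c (w , h) = c ∷ w , s≤s h
  words : ∀ m → List (Word m)
  words zero = ([] , z≤n) ∷ []
  words (suc m) = ([] , z≤n) ∷ cartesianProductWith extend (allFin t) (words m)
  complete : ∀ m (w : Word m) → Any (λ w′ → proj₁ w ≡ proj₁ w′) (words m)
  complete zero ([] , _) = here refl
  complete (suc m) ([] , _) = here refl
  complete (suc m) (c ∷ w , s≤s h) =
    there (cartesianProductWith⁺ extend (≡.cong₂ _∷_) (∈-allFin c) (complete m (w , h)))

∗-finite : (P Q : RPoset) → Finite (RPoset.poset P) → Finite (RPoset.poset Q) → Finite (P ∗ Q)
∗-finite P Q (ps , ps-complete) (qs , qs-complete) =
  concat (cartesianProductWith pair ps qs) , λ ((p , q) , h) →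
    concat⁺ (cartesianProductWith⁺ pair (pair-complete h) (ps-complete p) (qs-complete q))
  where
  module P = RPoset P
  module Q = RPoset Q
  pair : P.Carrier → Q.Carrier → List (Poset.Carrier (P ∗ Q))
  pair p q with Q.rank q ≤ℕ? P.rank p
  ... | yes h = ((p , q) , h) ∷ []
  ... | no _ = []
  pair-complete : ∀ {p q p′ q′} (h : Q.rank q ≤ℕ P.rank p) → p P.≈ p′ → q Q.≈ q′ →
                  Any (Poset._≈_ (P ∗ Q) ((p , q) , h)) (pair p′ q′)
  pair-complete {p} {q} {p′} {q′} h p≈p′ q≈q′ with Q.rank q′ ≤ℕ? P.rank p′
  ... | yes _ = here (p≈p′ , q≈q′)
  ... | no h′ = ⊥-elim (h′ (subst₂ _≤ℕ_ (Q.rank-resp q≈q′) (P.rank-resp p≈p′) h))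

module TreeRees (P : RPoset) (t n : ℕ)
    (rank-mono : ∀ {x y} → RPoset._≤_ P x y → RPoset.rank P x ≤ℕ RPoset.rank P y)
    (rank≤n : ∀ x → RPoset.rank P x ≤ℕ n) where
  open RPoset P using (_≤_; rank; module Eq)

  -- Above y = (p , q), only the part of a tree word beyond q matters:
  -- [y, ∞) ≅ [p, ∞) ∗ T_{t,n-k}, where k = rank p.
  up-rees : ∀ {k} (y : Poset.Carrier (P ∗ T t n)) → rank (proj₁ (proj₁ y)) ≡ k →
            Up (P ∗ T t n) y ≅ (UpR P (proj₁ (proj₁ y)) ∗ T t (n ∸ k))
  up-rees y@((p , (q , _)) , q≤p) refl =
    mk≅ {Up (P ∗ T t n) y} {UpR P p ∗ T t (n ∸ rank p)} to from
      (λ {z₁} {z₂} → to-mono {z₁} {z₂}) (λ {z₁} {z₂} → from-mono {z₁} {z₂})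
      (λ _ → Eq.refl , refl) (λ (_ , _ , (_ , q++s≡q′) , _) → Eq.refl , q++s≡q′)
    where
    Source = Poset.Carrier (Up (P ∗ T t n) y)
    Target = Poset.Carrier (UpR P p ∗ T t (n ∸ rank p))

    to : Source → Target
    to (((p′ , _) , _) , p≤p′ , (s , q++s≡q′) , rees) =
      ((p′ , p≤p′) , (s , ≤-trans s≤ (∸-monoˡ-≤ (rank p) (rank≤n p′)))) , s≤
      where
      s≤ : length s ≤ℕ rank p′ ∸ rank p
      s≤ = m+n≤o⇒m≤o∸n _ (Equivalence.to (rees-extension q s q++s≡q′) rees)

    from : Target → Source
    from (((p′ , p≤p′) , (s , _)) , s≤) =
      ((p′ , (q ++ s , ≤-trans qs≤p′ (rank≤n p′))) , qs≤p′) ,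
      p≤p′ , (s , refl) , Equivalence.from (rees-extension q s refl) s+k≤p′
      where
      s+k≤p′ : length s + rank p ≤ℕ rank p′
      s+k≤p′ = m≤o∸n⇒m+n≤o _ (rank-mono p≤p′) s≤
      qs≤p′ : length (q ++ s) ≤ℕ rank p′
      qs≤p′ = begin
        length (q ++ s)       ≡⟨ length-++ q ⟩
        length q + length s   ≡⟨ +-comm (length q) _ ⟩
        length s + length q   ≤⟨ +-monoʳ-≤ (length s) q≤p ⟩
        length s + rank p     ≤⟨ s+k≤p′ ⟩
        rank p′               ∎
        where open ≤-Reasoning

    shifted : ∀ {p₁ p₂} u → p ≤ p₁ → p ≤ p₂ →
              (length u + (rank p₁ ∸ rank p) ≤ℕ rank p₂ ∸ rank p) ⇔
              (length u + rank p₁ ≤ℕ rank p₂)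
    shifted u p≤p₁ p≤p₂ = ∸-shift (length u) (rank-mono p≤p₁) (rank-mono p≤p₂)

    to-mono : ∀ {z₁ z₂} → Poset._≤_ (Up (P ∗ T t n) y) z₁ z₂ →
              Poset._≤_ (UpR P p ∗ T t (n ∸ rank p)) (to z₁) (to z₂)
    to-mono {_ , p≤p₁ , (s₁ , q++s₁≡q₁) , _} {_ , p≤p₂ , (s₂ , q++s₂≡q₂) , _}
            (p₁≤p₂ , (u , q₁++u≡q₂) , rees) =
      p₁≤p₂ , (u , s₁++u≡s₂) ,
      Equivalence.from (rees-extension s₁ u s₁++u≡s₂)
        (Equivalence.from (shifted u p≤p₁ p≤p₂) (Equivalence.to (rees-extension _ u q₁++u≡q₂) rees))
      where
      s₁++u≡s₂ : s₁ ++ u ≡ s₂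
      s₁++u≡s₂ = ++-cancelˡ q _ _ (begin
        q ++ (s₁ ++ u)  ≡⟨ ≡.sym (++-assoc q s₁ u) ⟩
        (q ++ s₁) ++ u  ≡⟨ ≡.cong (_++ u) q++s₁≡q₁ ⟩
        _               ≡⟨ q₁++u≡q₂ ⟩
        _               ≡⟨ ≡.sym q++s₂≡q₂ ⟩
        q ++ s₂         ∎)
        where open ≡.≡-Reasoning

    from-mono : ∀ {z₁ z₂} → Poset._≤_ (UpR P p ∗ T t (n ∸ rank p)) z₁ z₂ →
                Poset._≤_ (Up (P ∗ T t n) y) (from z₁) (from z₂)
    from-mono {((_ , p≤p₁) , (s₁ , _)) , _} {((_ , p≤p₂) , (s₂ , _)) , _}
              (p₁≤p₂ , (u , s₁++u≡s₂) , rees) =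
      p₁≤p₂ , (u , q++s₁++u≡q++s₂) ,
      Equivalence.from (rees-extension (q ++ s₁) u q++s₁++u≡q++s₂)
        (Equivalence.to (shifted u p≤p₁ p≤p₂) (Equivalence.to (rees-extension s₁ u s₁++u≡s₂) rees))
      where
      q++s₁++u≡q++s₂ : (q ++ s₁) ++ u ≡ q ++ s₂
      q++s₁++u≡q++s₂ = ≡.trans (++-assoc q s₁ u) (≡.cong (q ++_) s₁++u≡s₂)

module ReesTree (P : RPoset) (uP : Uniform P) (t : ℕ) where
  open RPoset P using (Carrier; _≈_; _≤_; rank; rank-resp; module Eq; poset)
  open Uniform uP using (finite; top; top-max; bot; bot-min; rank-bot; rank-cov; uniform)
  open RankedFacts P finite rank-cov using (rank-mono; up-≅-rank)

  n : ℕ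
  n = rank top

  rank≤n : ∀ x → rank x ≤ℕ n
  rank≤n x = rank-mono (top-max x)

  open TreeRees P t n rank-mono rank≤n using (up-rees)

  S : Poset₀
  S = P ∗ T t n
  module S = Poset S

  R : Poset₀
  R = S ⁺

  first : S.Carrier → Carrier
  first = proj₁ ∘ proj₁

  rank-R : Poset.Carrier R → ℕ
  rank-R (just a) = rank (first a)
  rank-R nothing = suc n

  rank-R-resp : ∀ {a b} → Poset._≈_ R a b → rank-R a ≡ rank-R b
  rank-R-resp {just _} {just _} (p₁≈p₂ , _) = rank-resp p₁≈p₂
  rank-R-resp {nothing} {nothing} _ = refl

  same-first : ∀ {a b} → a S.≤ b → first a ≈ first b → a S.≈ b
  same-first {(_ , (q₁ , _)) , _} (_ , ([] , q₁++[]≡q₂) , _) p₁≈p₂ =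
    p₁≈p₂ , ≡.trans (≡.sym (++-identityʳ q₁)) q₁++[]≡q₂
  same-first {(p₁ , (q₁ , _)) , _} (_ , (x ∷ s , q₁++s≡q₂) , rees) p₁≈p₂ =
    ⊥-elim (1+n≰n (≤-trans (s≤s (m≤n+m (rank p₁) (length s)))
      (subst (suc (length s) + rank p₁ ≤ℕ_) (≡.sym (rank-resp p₁≈p₂))
        (Equivalence.to (rees-extension q₁ (x ∷ s) q₁++s≡q₂) rees))))

  -- If a ≤ b in S and p₁ ⋖ c ≤ p₂ for their first coordinates, then some element
  -- between a and b has first coordinate c: keep the tree word, or extend it by
  -- one letter towards that of b.
  interpolate : ∀ {a b c} → a S.≤ b → Covers poset (first a) c → c ≤ first b →
                Σ S.Carrier λ z → first z ≡ c × a S.≤ z × z S.≤ b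
  interpolate {(p₁ , (q₁ , q₁≤n)) , q₁≤p₁} {c = c} (_ , ([] , q₁++[]≡q₂) , _) p₁⋖c c≤p₂ =
    ((c , (q₁ , q₁≤n)) , ≤-trans q₁≤p₁ (rank-mono p₁≤c)) , refl ,
    (p₁≤c , ([] , ++-identityʳ q₁) ,
       Equivalence.from (rees-extension q₁ [] (++-identityʳ q₁)) (rank-mono p₁≤c)) ,
    (c≤p₂ , ([] , q₁++[]≡q₂) , Equivalence.from (rees-extension q₁ [] q₁++[]≡q₂) (rank-mono c≤p₂))
    where p₁≤c = proj₁ (proj₁ p₁⋖c)
  interpolate {(p₁ , (q₁ , _)) , q₁≤p₁} {(p₂ , (q₂ , q₂≤n)) , _} {c}
              (_ , (x ∷ s , q₁++xs≡q₂) , rees) p₁⋖c c≤p₂ =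
    ((c , (q′ , q′≤n)) , q′≤c) , refl ,
    (proj₁ (proj₁ p₁⋖c) , (x ∷ [] , refl) ,
       Equivalence.from (rees-extension q₁ (x ∷ []) refl) (≤-reflexive (≡.sym rank-c))) ,
    (c≤p₂ , (s , q′++s≡q₂) , Equivalence.from (rees-extension q′ s q′++s≡q₂) s+c≤p₂)
    where
    q′ = q₁ ++ x ∷ []
    rank-c : rank c ≡ suc (rank p₁)
    rank-c = rank-cov p₁ c p₁⋖c
    q′++s≡q₂ : q′ ++ s ≡ q₂
    q′++s≡q₂ = ≡.trans (++-assoc q₁ (x ∷ []) s) q₁++xs≡q₂
    q′≤n : length q′ ≤ℕ n
    q′≤n = ≤-trans (length-++-≤ˡ q′) (≤-trans (≤-reflexive (≡.cong length q′++s≡q₂)) q₂≤n)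
    q′≤c : length q′ ≤ℕ rank c
    q′≤c = ≤-trans (≤-reflexive (≡.trans (length-++ q₁) (+-comm (length q₁) 1)))
                   (≤-trans (s≤s q₁≤p₁) (≤-reflexive (≡.sym rank-c)))
    s+c≤p₂ : length s + rank c ≤ℕ rank p₂
    s+c≤p₂ = ≤-trans (≤-reflexive (≡.trans (≡.cong (length s +_) rank-c) (+-suc (length s) (rank p₁))))
                     (Equivalence.to (rees-extension q₁ (x ∷ s) q₁++xs≡q₂) rees)

  -- For a ⋖ b in S the first coordinates
  -- satisfy p₁ < p₂; interpolating at a cover p₁ ⋖ c ≤ p₂ gives an element
  -- strictly above a, hence equal to b, so rank p₂ = rank c = rank p₁ + 1.
  -- An element covered by the new maximum has first coordinate the top of P.
  rank-R-cov : ∀ a b → Covers R a b → rank-R b ≡ suc (rank-R a)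
  rank-R-cov (just a) (just b) ((a≤b , a≉b) , between) =
    classically {poset} finite (rank (first b) ≟ suc (rank (first a))) λ _≤?_ →
      let c , p₁⋖c , c≤p₂ = FiniteOrder.cover-below {poset} finite _≤?_
                              (proj₁ a≤b , a≉b ∘ same-first {a} {b} a≤b)
          z , first-z≡c , a≤z , z≤b = interpolate {a} {b} a≤b p₁⋖c c≤p₂
          c≈first : ∀ {w} → first z ≈ w → c ≈ w
          c≈first = Eq.trans (Eq.reflexive (≡.sym first-z≡c))
      in [ (λ z≈a → ⊥-elim (proj₂ (proj₁ p₁⋖c) (Eq.sym (c≈first (proj₁ z≈a)))))
         , (λ z≈b → ≡.trans (≡.sym (rank-resp (c≈first (proj₁ z≈b)))) (rank-cov _ c p₁⋖c)) ]′
         (between (just z) a≤z z≤b)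
  rank-R-cov (just a@((p , (q , q≤n)) , _)) nothing (_ , between) =
    [ (λ top≈p → ≡.cong suc (rank-resp (proj₁ top≈p))) , (λ ()) ]′ (between (just a′) a≤a′ tt)
    where
    a′ : S.Carrier
    a′ = (top , (q , q≤n)) , q≤n
    a≤a′ : a S.≤ a′
    a≤a′ = top-max p , ([] , ++-identityʳ q) ,
           Equivalence.from (rees-extension q [] (++-identityʳ q)) (rank≤n p)
  rank-R-cov nothing (just _) ((() , _) , _)
  rank-R-cov nothing nothing ((_ , nothing≉nothing) , _) = ⊥-elim (nothing≉nothing tt)

  bounded-ranked-R : IsBoundedRanked (withRank R rank-R (λ {a} {b} → rank-R-resp {a} {b}))
  bounded-ranked-R = record
    { finite = ⁺-finite {S} (∗-finite P (T t n) finite (T-finite t n))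
    ; bot = just bot-R
    ; top = nothing
    ; bot-min = λ where
        (just ((p , (q , _)) , q≤p)) → bot-min p , (q , refl) ,
          Equivalence.from (rees-extension [] q refl)
            (subst (λ r → length q + r ≤ℕ rank p) (≡.sym rank-bot)
                   (≤-trans (≤-reflexive (+-identityʳ _)) q≤p))
        nothing → tt
    ; top-max = λ where
        (just _) → tt
        nothing → tt
    ; rank-bot = rank-bot
    ; rank-cov = rank-R-cov }
    where
    bot-R : S.Carrier
    bot-R = (bot , ([] , z≤n)) , z≤n

  up-R : ∀ x (y : S.Carrier) → rank x ≡ rank (first y) →
         Up R (just y) ≅ ((UpR P x ∗ T t (n ∸ rank x)) ⁺)
  up-R x y@((p , _) , _) rx≡rp = begin
    Up R (just y)                     ≅⟨ up-⁺ S y ⟩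
    (Up S y ⁺)                        ≅⟨ ⁺-cong {Up S y} {UpR P x ∗ T t (n ∸ rank x)} up-S ⟩
    ((UpR P x ∗ T t (n ∸ rank x)) ⁺)  ∎
    where
    open ≅-Reasoning
    g : Up poset p ≅ Up poset x
    g = uniform p x (≡.sym rx≡rp)
    g-rank : ∀ z → rank (proj₁ (proj₁ g z)) ∸ rank x ≡ rank (proj₁ z) ∸ rank p
    g-rank z = ≡.cong₂ _∸_ (up-≅-rank g (≡.sym rx≡rp) z) rx≡rp
    up-S : Up S y ≅ (UpR P x ∗ T t (n ∸ rank x))
    up-S = begin
      Up S y                         ≅⟨ up-rees y (≡.sym rx≡rp) ⟩
      (UpR P p ∗ T t (n ∸ rank x))   ≅⟨ ∗-congˡ (UpR P p) (UpR P x) (T t (n ∸ rank x)) g g-rank ⟩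
      (UpR P x ∗ T t (n ∸ rank x))   ∎

  rank-R-below-top : ∀ a → ¬ rank-R (just a) ≡ rank-R nothing
  rank-R-below-top a e = 1+n≰n (≤-trans (≤-reflexive (≡.sym e)) (rank≤n (first a)))

  uniform-R : ∀ a b → rank-R a ≡ rank-R b → Up R a ≅ Up R b
  uniform-R (just a) (just b) e = begin
    Up R (just a)                                    ≅⟨ up-R (first a) a refl ⟩
    ((UpR P (first a) ∗ T t (n ∸ rank (first a))) ⁺)  ≅˘⟨ up-R (first a) b e ⟩
    Up R (just b)                                    ∎
    where open ≅-Reasoning
  uniform-R (just a) nothing e = ⊥-elim (rank-R-below-top a e)
  uniform-R nothing (just b) e = ⊥-elim (rank-R-below-top b (≡.sym e))
  uniform-R nothing nothing _ = ≅-refl (Up R nothing)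

  R-uniform : Uniform (withRank R rank-R (λ {a} {b} → rank-R-resp {a} {b}))
  R-uniform = record { boundedRanked = bounded-ranked-R ; uniform = uniform-R }

  upper-intervals : ∀ x y k → rank x ≡ k → rank-R y ≡ k → Up R y ≅ ((UpR P x ∗ T t (n ∸ k)) ⁺)
  upper-intervals x (just y) _ refl ry≡rx = up-R x y (≡.sym ry≡rx)
  upper-intervals x nothing _ refl ry≡rx = ⊥-elim (1+n≰n (≤-trans (≤-reflexive ry≡rx) (rank≤n x)))

open import Data.Nat using (_≤_)

proposition3p3 : (P : RPoset) (n t : ℕ) → 1 ≤ t →
    (uP : Uniform P) → Uniform.len uP ≡ n →
    Σ (Poset.Carrier ((P ∗ T t n) ⁺) → ℕ) λ r →
    Σ (∀ {a b} → Poset._≈_ ((P ∗ T t n) ⁺) a b → r a ≡ r b) λ resp →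
    Σ (Uniform (withRank ((P ∗ T t n) ⁺) r resp)) λ uR →
      (Uniform.len uR ≡ suc n) ×
      (∀ (x : RPoset.Carrier P) (y : Poset.Carrier ((P ∗ T t n) ⁺)) (k : ℕ) →
         RPoset.rank P x ≡ k → r y ≡ k →
         Up ((P ∗ T t n) ⁺) y ≅ ((UpR P x ∗ T t (n ∸ k)) ⁺))
proposition3p3 P _ t _ uP refl =
  rank-R , (λ {a} {b} → rank-R-resp {a} {b}) , R-uniform , refl , upper-intervals
  where open ReesTree P uP t
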